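{- For every positive integer $n$, the set $\mathrm{Alt}_n$ of alternating permutations in $S_n$, equipped with the restriction of the left middle order, is a distributive lattice.
   Context: A permutation $\sigma\in S_n$ is alternating if $\sigma(1)>\sigma(2)<\sigma(3)>\sigma(4)<\cdots$. The Lehmer code of $\sigma$ is $(L_1,\dots,L_n)$ with $L_i=\#\{j>i:\sigma(j)<\sigma(i)\}$. The left middle order on $S_n$ is defined by $\sigma\le\tau$ iff $L_i(\sigma)\le L_i(\tau)$ for all $i$; its restriction to $\mathrm{Alt}_n$ is the induced partial order. -}

module Defs where

open import Data.Nat using (ℕ; zero; suc; _%_; _≤_)
open import Data.Fin using (Fin; toℕ; _<?_) renaming (_<_ to _<ᶠ_)
open import Data.Fin.Permutation using (Permutation′; _⟨$⟩ʳ_)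
open import Data.List using (length; filter; allFin)
open import Data.Product using (Σ; _×_; proj₁)
open import Relation.Nullary.Decidable using (_×-dec_)
open import Relation.Binary.PropositionalEquality using (_≡_)

-- Positions are 0-indexed: position i here is position i+1 in the paper.
Alternating : ∀ {n} → Permutation′ n → Set
Alternating {n} σ = ∀ (i j : Fin n) → toℕ j ≡ suc (toℕ i) →
  ((toℕ i % 2 ≡ 0 → (σ ⟨$⟩ʳ j) <ᶠ (σ ⟨$⟩ʳ i)) ×
   (toℕ i % 2 ≡ 1 → (σ ⟨$⟩ʳ i) <ᶠ (σ ⟨$⟩ʳ j)))

lehmer : ∀ {n} → Permutation′ n → Fin n → ℕ
lehmer {n} σ i =
  length (filter (λ j → (i <? j) ×-dec ((σ ⟨$⟩ʳ j) <? (σ ⟨$⟩ʳ i))) (allFin n))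

_≤LM_ : ∀ {n} → Permutation′ n → Permutation′ n → Set
_≤LM_ {n} σ τ = ∀ (i : Fin n) → lehmer σ i ≤ lehmer τ i

Alt : ℕ → Set
Alt n = Σ (Permutation′ n) Alternating

_≈Alt_ : ∀ {n} → Alt n → Alt n → Set
_≈Alt_ {n} σ τ = ∀ (i : Fin n) → proj₁ σ ⟨$⟩ʳ i ≡ proj₁ τ ⟨$⟩ʳ i

_≤Alt_ : ∀ {n} → Alt n → Alt n → Set
σ ≤Alt τ = proj₁ σ ≤LM proj₁ τ

{-# OPTIONS --safe #-}
module Submission where

-- The Lehmer code is a bijection from S_n onto the subexcedant sequences
-- (c_i ≤ n − 1 − i, positions and values 0-indexed), and it turns the left
-- middle order into the pointwise order. Everything follows from the recursion
-- L(σ) = (σ(0), L(σ')), where σ' is σ with its first entry deleted and the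
-- remaining values renumbered. In particular σ(i) > σ(i+1) iff L_i > L_{i+1},
-- so σ is alternating iff its code strictly descends at even i and weakly
-- ascends at odd i. These conditions, like subexcedance, are preserved by
-- pointwise max and min, so the codes of Alt_n form a sublattice of the
-- distributive lattice ℕ^n.

open import Defs
open import Data.Nat using (ℕ; _≤_)
open import Data.Product using (Σ)
open import Relation.Binary.Lattice.Structures using (IsDistributiveLattice)

open import Algebra.Core using (Op₂)
open import Data.Bool.Base using (if_then_else_)
open import Data.Fin as F using (Fin; zero; suc; toℕ; punchIn; fromℕ<)
open import Data.Fin.Permutation as Perm using (Permutation′; _⟨$⟩ʳ_; remove; insert; punchIn-permute; insert-punchIn)
open import Data.Fin.Properties using (toℕ-injective; toℕ-fromℕ<; toℕ<n; punchIn-mono-≤; punchIn-cancel-≤)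
  renaming (<-cmp to <-cmpᶠ)
open import Data.List using (length; filter; tabulate)
open import Data.Nat as ℕ using (zero; suc; _<_; _⊔_; _⊓_; _∸_; _%_; s≤s; s≤s⁻¹; z≤n)
open import Data.Nat.Properties
open import Algebra.Properties.CommutativeMonoid.Sum +-0-commutativeMonoid using (sum; sum-permute; sum-cong-≗)
open import Data.Product using (_×_; _,_; proj₁; proj₂)
open import Function using (_∘_; _⇔_; mk⇔; Equivalence; Injection)
open import Function.Properties.Inverse using (↔⇒↣)
open import Level using (Level)
open import Relation.Binary.Core using (Rel)
open import Relation.Binary.Definitions using (tri<; tri≈; tri>)
open import Relation.Binary.PropositionalEquality
open import Relation.Nullary using (Dec; does; yes; no; contradiction)
open import Relation.Nullary.Decidable using (_×-dec_; does-⇔)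
open import Relation.Unary using (Pred; Decidable)

private
  variable
    p q : Level
    n : ℕ

-- Counting

indicator : {P : Set p} → Dec P → ℕ
indicator P? = if does P? then 1 else 0

count : {P : Pred (Fin n) p} → Decidable P → ℕ
count P? = sum (indicator ∘ P?)

count-cong : {P : Pred (Fin n) p} {Q : Pred (Fin n) q} (P? : Decidable P) (Q? : Decidable Q) →
             (∀ j → P j ⇔ Q j) → count P? ≡ count Q?
count-cong P? Q? P⇔Q = sum-cong-≗ λ j → cong (λ b → if b then 1 else 0) (does-⇔ (P⇔Q j) (P? j) (Q? j))

count-permute : {P : Pred (Fin n) p} (P? : Decidable P) (π : Permutation′ n) →
                count (P? ∘ (π ⟨$⟩ʳ_)) ≡ count P?
count-permute P? π = sym (sum-permute (indicator ∘ P?) π)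

below? : (t : ℕ) → Decidable (λ (v : Fin n) → toℕ v < t)
below? t v = toℕ v ℕ.<? t

count-below : ∀ m t → count (below? {m} t) ≡ t ⊓ m
count-below zero    t       = sym (⊓-zeroʳ t)
count-below (suc m) zero    =
  trans (count-cong (below? {suc m} 0 ∘ suc) (below? 0) λ _ → mk⇔ (λ ()) (λ ())) (count-below m 0)
count-below (suc m) (suc t) =
  cong suc (trans (count-cong (below? {suc m} (suc t) ∘ suc) (below? t) λ _ → mk⇔ s≤s⁻¹ s≤s)
                  (count-below m t))

length-filter-tabulate : {A : Set} {P : Pred A p} (P? : Decidable P) (f : Fin n → A) →
                         length (filter P? (tabulate f)) ≡ count (P? ∘ f)
length-filter-tabulate {n = zero}  P? f = refl
length-filter-tabulate {n = suc n} P? f with P? (f zero)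
... | yes _ = cong suc (length-filter-tabulate P? (f ∘ suc))
... | no _  = length-filter-tabulate P? (f ∘ suc)

module _ (i : Fin (suc n)) where

  punchIn-mono-< : ∀ {j k : Fin n} → j F.< k → punchIn i j F.< punchIn i k
  punchIn-mono-< {j} {k} j<k = ≰⇒> (<⇒≱ j<k ∘ punchIn-cancel-≤ i k j)

  punchIn-cancel-< : ∀ {j k : Fin n} → punchIn i j F.< punchIn i k → j F.< k
  punchIn-cancel-< {j} {k} ij<ik = ≰⇒> (<⇒≱ ij<ik ∘ punchIn-mono-≤ i k j)

punchIn<⇔< : (i : Fin (suc n)) (j : Fin n) → punchIn i j F.< i ⇔ j F.< i
punchIn<⇔< i j = mk⇔ (to i j) (from i j)
  where
  to : ∀ {n} (i : Fin (suc n)) (j : Fin n) → punchIn i j F.< i → j F.< i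
  to (suc i) zero    _         = s≤s z≤n
  to (suc i) (suc j) (s≤s ij<i) = s≤s (to i j ij<i)
  from : ∀ {n} (i : Fin (suc n)) (j : Fin n) → j F.< i → punchIn i j F.< i
  from (suc i) zero    _        = s≤s z≤n
  from (suc i) (suc j) (s≤s j<i) = s≤s (from i j j<i)

<punchIn⇒≤ : (i : Fin (suc n)) (j : Fin n) → i F.< punchIn i j → i F.≤ j
<punchIn⇒≤ zero    j       _          = z≤n
<punchIn⇒≤ (suc i) (suc j) (s≤s i<ij) = s≤s (<punchIn⇒≤ i j i<ij)

-- Lehmer codes

Inversion : Permutation′ n → Fin n → Fin n → Set
Inversion σ i j = i F.< j × σ ⟨$⟩ʳ j F.< σ ⟨$⟩ʳ i

inversion? : (σ : Permutation′ n) (i : Fin n) → Decidable (Inversion σ i)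
inversion? σ i j = (i F.<? j) ×-dec (σ ⟨$⟩ʳ j F.<? σ ⟨$⟩ʳ i)

lehmer-count : (σ : Permutation′ n) (i : Fin n) → lehmer σ i ≡ count (inversion? σ i)
lehmer-count σ i = length-filter-tabulate (inversion? σ i) (λ j → j)

inversion-cong : (σ τ : Permutation′ n) → σ Perm.≈ τ → ∀ {i j} → Inversion σ i j → Inversion τ i j
inversion-cong σ τ σ≈τ {i} {j} (i<j , σj<σi) = i<j , subst₂ F._<_ (σ≈τ j) (σ≈τ i) σj<σi

lehmer-cong : (σ τ : Permutation′ n) → σ Perm.≈ τ → ∀ i → lehmer σ i ≡ lehmer τ i
lehmer-cong σ τ σ≈τ i = begin
  lehmer σ i              ≡⟨ lehmer-count σ i ⟩
  count (inversion? σ i)  ≡⟨ count-cong (inversion? σ i) (inversion? τ i) (λ _ → σ⇔τ) ⟩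
  count (inversion? τ i)  ≡⟨ lehmer-count τ i ⟨
  lehmer τ i              ∎
  where
  open ≡-Reasoning
  σ⇔τ : ∀ {j} → Inversion σ i j ⇔ Inversion τ i j
  σ⇔τ = mk⇔ (inversion-cong σ τ σ≈τ) (inversion-cong τ σ (sym ∘ σ≈τ))

module LehmerRecursion (σ : Permutation′ (suc n)) (c : Fin (suc n)) (π : Permutation′ n)
  (σ-zero : σ ⟨$⟩ʳ zero ≡ c) (σ-suc : ∀ k → σ ⟨$⟩ʳ suc k ≡ punchIn c (π ⟨$⟩ʳ k)) where

  open ≡-Reasoning

  -- The summand j = zero of each inversion count vanishes definitionally.
  lehmer-zero : lehmer σ zero ≡ toℕ c
  lehmer-zero = begin
    lehmer σ zero
      ≡⟨ lehmer-count σ zero ⟩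
    count (inversion? σ zero)
      ≡⟨⟩
    count (inversion? σ zero ∘ suc)
      ≡⟨ count-cong (inversion? σ zero ∘ suc) (below? (toℕ c) ∘ (π ⟨$⟩ʳ_)) (λ _ → inversion⇔) ⟩
    count (below? (toℕ c) ∘ (π ⟨$⟩ʳ_))
      ≡⟨ count-permute (below? (toℕ c)) π ⟩
    count (below? {n} (toℕ c))
      ≡⟨ count-below n (toℕ c) ⟩
    toℕ c ⊓ n
      ≡⟨ m≤n⇒m⊓n≡m (≤-pred (toℕ<n c)) ⟩
    toℕ c
      ∎
    where
    inversion⇔ : ∀ {k} → Inversion σ zero (suc k) ⇔ π ⟨$⟩ʳ k F.< c
    inversion⇔ {k} = mk⇔
      (λ (_ , σk<σ0) → Equivalence.to (punchIn<⇔< c _) (subst₂ F._<_ (σ-suc k) σ-zero σk<σ0))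
      (λ πk<c → s≤s z≤n ,
                subst₂ F._<_ (sym (σ-suc k)) (sym σ-zero) (Equivalence.from (punchIn<⇔< c _) πk<c))

  lehmer-suc : ∀ i → lehmer σ (suc i) ≡ lehmer π i
  lehmer-suc i = begin
    lehmer σ (suc i)
      ≡⟨ lehmer-count σ (suc i) ⟩
    count (inversion? σ (suc i))
      ≡⟨⟩
    count (inversion? σ (suc i) ∘ suc)
      ≡⟨ count-cong (inversion? σ (suc i) ∘ suc) (inversion? π i) (λ _ → inversion⇔) ⟩
    count (inversion? π i)
      ≡⟨ lehmer-count π i ⟨
    lehmer π i
      ∎
    where
    inversion⇔ : ∀ {k} → Inversion σ (suc i) (suc k) ⇔ Inversion π i k
    inversion⇔ {k} = mk⇔
      (λ { (s≤s i<k , σk<σi) → i<k , punchIn-cancel-< c (subst₂ F._<_ (σ-suc k) (σ-suc i) σk<σi) })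
      (λ (i<k , πk<πi) → s≤s i<k , subst₂ F._<_ (sym (σ-suc k)) (sym (σ-suc i)) (punchIn-mono-< c πk<πi))

open module LehmerRemove {n} (σ : Permutation′ (suc n)) =
  LehmerRecursion σ (σ ⟨$⟩ʳ zero) (remove zero σ) refl (punchIn-permute σ zero)

Subexcedant : ∀ n → (Fin n → ℕ) → Set
Subexcedant n c = ∀ i → c i ≤ n ∸ suc (toℕ i)

lehmer-subexcedant : (σ : Permutation′ n) → Subexcedant n (lehmer σ)
lehmer-subexcedant {suc n} σ zero    rewrite lehmer-zero σ  = ≤-pred (toℕ<n (σ ⟨$⟩ʳ zero))
lehmer-subexcedant {suc n} σ (suc i) rewrite lehmer-suc σ i = lehmer-subexcedant (remove zero σ) i

fromLehmer : (c : Fin n → ℕ) → Subexcedant n c → Permutation′ n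
fromLehmer {zero}  c c≤ = Perm.id
fromLehmer {suc n} c c≤ = insert zero (fromℕ< (s≤s (c≤ zero))) (fromLehmer (c ∘ suc) (c≤ ∘ suc))

lehmer-fromLehmer : (c : Fin n → ℕ) (c≤ : Subexcedant n c) → ∀ i → lehmer (fromLehmer c c≤) i ≡ c i
lehmer-fromLehmer {suc n} c c≤ = λ
  { zero    → trans R.lehmer-zero (toℕ-fromℕ< (s≤s (c≤ zero)))
  ; (suc i) → trans (R.lehmer-suc i) (lehmer-fromLehmer (c ∘ suc) (c≤ ∘ suc) i)
  }
  where
  c₀ : Fin (suc n)
  c₀ = fromℕ< (s≤s (c≤ zero))
  π : Permutation′ n
  π = fromLehmer (c ∘ suc) (c≤ ∘ suc)
  module R = LehmerRecursion (fromLehmer c c≤) c₀ π refl (insert-punchIn zero c₀ π)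

lehmer-zero-injective : (σ τ : Permutation′ (suc n)) →
                        lehmer σ zero ≡ lehmer τ zero → σ ⟨$⟩ʳ zero ≡ τ ⟨$⟩ʳ zero
lehmer-zero-injective σ τ eq = toℕ-injective (trans (sym (lehmer-zero σ)) (trans eq (lehmer-zero τ)))

lehmer-injective : (σ τ : Permutation′ n) → (∀ i → lehmer σ i ≡ lehmer τ i) → σ Perm.≈ τ
lehmer-injective {suc n} σ τ eq zero    = lehmer-zero-injective σ τ (eq zero)
lehmer-injective {suc n} σ τ eq (suc k) = begin
  σ ⟨$⟩ʳ suc k                                  ≡⟨ punchIn-permute σ zero k ⟩
  punchIn (σ ⟨$⟩ʳ zero) (remove zero σ ⟨$⟩ʳ k)  ≡⟨ cong₂ punchIn heads (tails k) ⟩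
  punchIn (τ ⟨$⟩ʳ zero) (remove zero τ ⟨$⟩ʳ k)  ≡⟨ punchIn-permute τ zero k ⟨
  τ ⟨$⟩ʳ suc k                                  ∎
  where
  open ≡-Reasoning
  heads : σ ⟨$⟩ʳ zero ≡ τ ⟨$⟩ʳ zero
  heads = lehmer-zero-injective σ τ (eq zero)
  tails : remove zero σ Perm.≈ remove zero τ
  tails = lehmer-injective (remove zero σ) (remove zero τ) λ i →
    trans (sym (lehmer-suc σ i)) (trans (eq (suc i)) (lehmer-suc τ i))

remove-zero-< : (σ : Permutation′ (suc n)) {i j : Fin n} →
                σ ⟨$⟩ʳ suc i F.< σ ⟨$⟩ʳ suc j → remove zero σ ⟨$⟩ʳ i F.< remove zero σ ⟨$⟩ʳ j
remove-zero-< σ {i} {j} σi<σj =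
  punchIn-cancel-< (σ ⟨$⟩ʳ zero) (subst₂ F._<_ (punchIn-permute σ zero i) (punchIn-permute σ zero j) σi<σj)

lehmer-one : (σ : Permutation′ (suc (suc n))) → lehmer σ (suc zero) ≡ toℕ (remove zero σ ⟨$⟩ʳ zero)
lehmer-one σ = trans (lehmer-suc σ zero) (lehmer-zero (remove zero σ))

lehmer-descent : (σ : Permutation′ n) {i j : Fin n} → toℕ j ≡ suc (toℕ i) →
                 σ ⟨$⟩ʳ j F.< σ ⟨$⟩ʳ i → lehmer σ j < lehmer σ i
lehmer-descent {suc (suc n)} σ {zero} {suc zero} refl σ₁<σ₀ = begin-strict
  lehmer σ (suc zero)            ≡⟨ lehmer-one σ ⟩
  toℕ (remove zero σ ⟨$⟩ʳ zero)  <⟨ Equivalence.to (punchIn<⇔< σ₀ _) σ₁<σ₀′ ⟩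
  toℕ σ₀                         ≡⟨ lehmer-zero σ ⟨
  lehmer σ zero                  ∎
  where
  open ≤-Reasoning
  σ₀ : Fin (suc (suc n))
  σ₀ = σ ⟨$⟩ʳ zero
  σ₁<σ₀′ : punchIn σ₀ (remove zero σ ⟨$⟩ʳ zero) F.< σ₀
  σ₁<σ₀′ = subst (F._< σ₀) (punchIn-permute σ zero zero) σ₁<σ₀
lehmer-descent σ {suc i} {suc j} 1+i≡j σj<σi = begin-strict
  lehmer σ (suc j)          ≡⟨ lehmer-suc σ j ⟩
  lehmer (remove zero σ) j  <⟨ lehmer-descent (remove zero σ) (suc-injective 1+i≡j) (remove-zero-< σ σj<σi) ⟩
  lehmer (remove zero σ) i  ≡⟨ lehmer-suc σ i ⟨
  lehmer σ (suc i)          ∎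
  where open ≤-Reasoning

lehmer-ascent : (σ : Permutation′ n) {i j : Fin n} → toℕ j ≡ suc (toℕ i) →
                σ ⟨$⟩ʳ i F.< σ ⟨$⟩ʳ j → lehmer σ i ≤ lehmer σ j
lehmer-ascent {suc (suc n)} σ {zero} {suc zero} refl σ₀<σ₁ = begin
  lehmer σ zero                  ≡⟨ lehmer-zero σ ⟩
  toℕ σ₀                         ≤⟨ <punchIn⇒≤ σ₀ _ σ₀<σ₁′ ⟩
  toℕ (remove zero σ ⟨$⟩ʳ zero)  ≡⟨ lehmer-one σ ⟨
  lehmer σ (suc zero)            ∎
  where
  open ≤-Reasoning
  σ₀ : Fin (suc (suc n))
  σ₀ = σ ⟨$⟩ʳ zero
  σ₀<σ₁′ : σ₀ F.< punchIn σ₀ (remove zero σ ⟨$⟩ʳ zero)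
  σ₀<σ₁′ = subst (σ₀ F.<_) (punchIn-permute σ zero zero) σ₀<σ₁
lehmer-ascent σ {suc i} {suc j} 1+i≡j σi<σj = begin
  lehmer σ (suc i)          ≡⟨ lehmer-suc σ i ⟩
  lehmer (remove zero σ) i  ≤⟨ lehmer-ascent (remove zero σ) (suc-injective 1+i≡j) (remove-zero-< σ σi<σj) ⟩
  lehmer (remove zero σ) j  ≡⟨ lehmer-suc σ j ⟨
  lehmer σ (suc j)          ∎
  where open ≤-Reasoning

module _ (σ : Permutation′ n) {i j : Fin n} (adjacent : toℕ j ≡ suc (toℕ i)) where

  private
    σ-distinct : σ ⟨$⟩ʳ j ≢ σ ⟨$⟩ʳ i
    σ-distinct σj≡σi = 1+n≢n (trans (sym adjacent) (cong toℕ (Injection.injective (↔⇒↣ σ) σj≡σi)))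

  descent-from-lehmer : lehmer σ j < lehmer σ i → σ ⟨$⟩ʳ j F.< σ ⟨$⟩ʳ i
  descent-from-lehmer Lj<Li with <-cmpᶠ (σ ⟨$⟩ʳ j) (σ ⟨$⟩ʳ i)
  ... | tri< σj<σi _ _ = σj<σi
  ... | tri≈ _ σj≡σi _ = contradiction σj≡σi σ-distinct
  ... | tri> _ _ σi<σj = contradiction (lehmer-ascent σ adjacent σi<σj) (<⇒≱ Lj<Li)

  ascent-from-lehmer : lehmer σ i ≤ lehmer σ j → σ ⟨$⟩ʳ i F.< σ ⟨$⟩ʳ j
  ascent-from-lehmer Li≤Lj with <-cmpᶠ (σ ⟨$⟩ʳ j) (σ ⟨$⟩ʳ i)
  ... | tri< σj<σi _ _ = contradiction (lehmer-descent σ adjacent σj<σi) (≤⇒≯ Li≤Lj)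
  ... | tri≈ _ σj≡σi _ = contradiction σj≡σi σ-distinct
  ... | tri> _ _ σi<σj = σi<σj

-- Alternating codes

AlternatingCode : (Fin n → ℕ) → Set
AlternatingCode {n} c = ∀ (i j : Fin n) → toℕ j ≡ suc (toℕ i) →
  ((toℕ i % 2 ≡ 0 → c j < c i) × (toℕ i % 2 ≡ 1 → c i ≤ c j))

alternating⇒code : (σ : Permutation′ n) → Alternating σ → AlternatingCode (lehmer σ)
alternating⇒code σ alt i j adjacent =
  lehmer-descent σ adjacent ∘ proj₁ (alt i j adjacent) ,
  lehmer-ascent σ adjacent ∘ proj₂ (alt i j adjacent)

code⇒alternating : (σ : Permutation′ n) → AlternatingCode (lehmer σ) → Alternating σ
code⇒alternating σ alt i j adjacent =
  descent-from-lehmer σ adjacent ∘ proj₁ (alt i j adjacent) ,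
  ascent-from-lehmer σ adjacent ∘ proj₂ (alt i j adjacent)

AlternatingCode-resp-≗ : {c d : Fin n → ℕ} → (∀ i → c i ≡ d i) → AlternatingCode c → AlternatingCode d
AlternatingCode-resp-≗ c≗d alt i j adjacent =
  subst₂ _<_ (c≗d j) (c≗d i) ∘ proj₁ (alt i j adjacent) ,
  subst₂ _≤_ (c≗d i) (c≗d j) ∘ proj₂ (alt i j adjacent)

AlternatingCode-⊔ : {c d : Fin n → ℕ} → AlternatingCode c → AlternatingCode d →
                    AlternatingCode (λ i → c i ⊔ d i)
AlternatingCode-⊔ altc altd i j adjacent =
  (λ even → ⊔-mono-< (proj₁ (altc i j adjacent) even) (proj₁ (altd i j adjacent) even)) ,
  (λ odd  → ⊔-mono-≤ (proj₂ (altc i j adjacent) odd)  (proj₂ (altd i j adjacent) odd))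

AlternatingCode-⊓ : {c d : Fin n → ℕ} → AlternatingCode c → AlternatingCode d →
                    AlternatingCode (λ i → c i ⊓ d i)
AlternatingCode-⊓ altc altd i j adjacent =
  (λ even → ⊓-mono-< (proj₁ (altc i j adjacent) even) (proj₁ (altd i j adjacent) even)) ,
  (λ odd  → ⊓-mono-≤ (proj₂ (altc i j adjacent) odd)  (proj₂ (altd i j adjacent) odd))

-- Sublattices of ℕ^I

module _ {a ℓ} {I : Set} {A : Set a} {_≈_ : Rel A ℓ} (code : A → I → ℕ)
         (code-cong : ∀ {x y} → x ≈ y → ∀ i → code x i ≡ code y i)
         (code-injective : ∀ {x y} → (∀ i → code x i ≡ code y i) → x ≈ y)
         {_∨_ _∧_ : Op₂ A}
         (code-∨ : ∀ x y i → code (x ∨ y) i ≡ code x i ⊔ code y i)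
         (code-∧ : ∀ x y i → code (x ∧ y) i ≡ code x i ⊓ code y i)
         where

  sublattice-isDistributiveLattice :
    IsDistributiveLattice _≈_ (λ x y → ∀ i → code x i ≤ code y i) _∨_ _∧_
  sublattice-isDistributiveLattice = record
    { isLattice = record
      { isPartialOrder = record
        { isPreorder = record
          { isEquivalence = record
            { refl  = code-injective λ _ → refl
            ; sym   = λ x≈y → code-injective (sym ∘ code-cong x≈y)
            ; trans = λ x≈y y≈z → code-injective λ i → trans (code-cong x≈y i) (code-cong y≈z i)
            }
          ; reflexive = λ x≈y → ≤-reflexive ∘ code-cong x≈y
          ; trans     = λ x≤y y≤z i → ≤-trans (x≤y i) (y≤z i)
          }
        ; antisym = λ x≤y y≤x → code-injective λ i → ≤-antisym (x≤y i) (y≤x i)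
        }
      ; supremum = λ x y →
          (λ i → subst (code x i ≤_) (sym (code-∨ x y i)) (m≤m⊔n _ _)) ,
          (λ i → subst (code y i ≤_) (sym (code-∨ x y i)) (m≤n⊔m _ _)) ,
          (λ z x≤z y≤z i → subst (_≤ code z i) (sym (code-∨ x y i)) (⊔-lub (x≤z i) (y≤z i)))
      ; infimum = λ x y →
          (λ i → subst (_≤ code x i) (sym (code-∧ x y i)) (m⊓n≤m _ _)) ,
          (λ i → subst (_≤ code y i) (sym (code-∧ x y i)) (m⊓n≤n _ _)) ,
          (λ z z≤x z≤y i → subst (code z i ≤_) (sym (code-∧ x y i)) (⊓-glb (z≤x i) (z≤y i)))
      }
    ; ∧-distribˡ-∨ = λ x y z → code-injective (∧-distribˡ-∨ x y z)
    }
    where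
    ∧-distribˡ-∨ : ∀ x y z i → code (x ∧ (y ∨ z)) i ≡ code ((x ∧ y) ∨ (x ∧ z)) i
    ∧-distribˡ-∨ x y z i = begin
      code (x ∧ (y ∨ z)) i                      ≡⟨ code-∧ x (y ∨ z) i ⟩
      code x i ⊓ code (y ∨ z) i                 ≡⟨ cong (code x i ⊓_) (code-∨ y z i) ⟩
      code x i ⊓ (code y i ⊔ code z i)          ≡⟨ ⊓-distribˡ-⊔ (code x i) (code y i) (code z i) ⟩
      code x i ⊓ code y i ⊔ code x i ⊓ code z i ≡⟨ cong₂ _⊔_ (code-∧ x y i) (code-∧ x z i) ⟨
      code (x ∧ y) i ⊔ code (x ∧ z) i           ≡⟨ code-∨ (x ∧ y) (x ∧ z) i ⟨
      code ((x ∧ y) ∨ (x ∧ z)) i                ∎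
      where open ≡-Reasoning

-- The lattice Alt n

module AltLattice (n : ℕ) where

  code : Alt n → Fin n → ℕ
  code = lehmer ∘ proj₁

  fromCode : (c : Fin n → ℕ) → Subexcedant n c → AlternatingCode c → Alt n
  fromCode c c≤ alt = fromLehmer c c≤ ,
    code⇒alternating (fromLehmer c c≤) (AlternatingCode-resp-≗ (sym ∘ lehmer-fromLehmer c c≤) alt)

  code-subexcedant : (σ : Alt n) → Subexcedant n (code σ)
  code-subexcedant = lehmer-subexcedant ∘ proj₁

  code-alternating : (σ : Alt n) → AlternatingCode (code σ)
  code-alternating (σ , alt) = alternating⇒code σ alt

  _∨_ : Op₂ (Alt n)
  σ ∨ τ = fromCode (λ i → code σ i ⊔ code τ i)
                   (λ i → ⊔-lub (code-subexcedant σ i) (code-subexcedant τ i))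
                   (AlternatingCode-⊔ (code-alternating σ) (code-alternating τ))

  _∧_ : Op₂ (Alt n)
  σ ∧ τ = fromCode (λ i → code σ i ⊓ code τ i)
                   (λ i → ≤-trans (m⊓n≤m _ _) (code-subexcedant σ i))
                   (AlternatingCode-⊓ (code-alternating σ) (code-alternating τ))

  isDistributiveLattice : IsDistributiveLattice (_≈Alt_ {n}) (_≤Alt_ {n}) _∨_ _∧_
  isDistributiveLattice = sublattice-isDistributiveLattice code
    (λ {σ} {τ} → lehmer-cong (proj₁ σ) (proj₁ τ))
    (λ {σ} {τ} → lehmer-injective (proj₁ σ) (proj₁ τ))
    (λ _ _ → lehmer-fromLehmer _ _)
    (λ _ _ → lehmer-fromLehmer _ _)

corollary2 : (n : ℕ) → 1 ≤ n →
    Σ (Alt n → Alt n → Alt n) λ join →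
    Σ (Alt n → Alt n → Alt n) λ meet →
    IsDistributiveLattice (_≈Alt_ {n}) (_≤Alt_ {n}) join meet
corollary2 n _ = AltLattice._∨_ n , AltLattice._∧_ n , AltLattice.isDistributiveLattice n
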